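{- (i) For any $\bm{\gamma}\in\{0,1\}^{\infty}$ and $a\in\mathbb{Z}_{\ge0}$, ${\ast}^{\bm{\gamma}}a+\emptyset^1\cong{\ast}^{\bm{1}}a$. (ii) For any game with activeness $G^g$, $G^g+\emptyset^1={\ast}^{\bm{0}}\mathcal{G}(G^g)+\emptyset^1$. (iii) For any $a,b\in\mathbb{Z}_{\ge0}$: ${\ast}^{\bm{0}}a+{\ast}^{\bm{0}}b={\ast}^{\bm{0}}(a\oplus b)$, ${\ast}^{\bm{0}}a+{\ast}^{\bm{1}}b={\ast}^{\bm{1}}(a\oplus b)$, and ${\ast}^{\bm{1}}a+{\ast}^{\bm{1}}b={\ast}^{\bm{1}}(a\oplus b)$.
   Context: Let $\mathcal{B}=\{0,1\}$. Define $\mathbb{I}_0=\{\emptyset\}\times\mathcal{B}$ and $\mathbb{I}_n=2^{\mathbb{I}_{n-1}}\times\mathcal{B}$ for $n\ge1$; a game with activeness is an element of $\mathbb{I}=\bigcup_{n\ge0}\mathbb{I}_n$. A pair $(G,g)$ is written $G^g$; elements of $G$ are its options, $g=1$ meaning active; $\cong$ denotes identity of elements of $\mathbb{I}$. The outcome $o$ is defined recursively: $o(G^g)=\mathscr{N}$ if $g=1$ and some option has outcome $\mathscr{P}$, and $o(G^g)=\mathscr{P}$ otherwise. The sum is $G^g+H^h=(\{G'^{g'}+H^h:G'^{g'}\in G^g\}\cup\{G^g+H'^{h'}:H'^{h'}\in H^h\})^{\max\{g,h\}}$. $G^g=H^h$ means $o(G^g+X^x)=o(H^h+X^x)$ for all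 games $X^x$. For $\bm{\gamma}\in\mathcal{B}^\infty$, ${\ast}^{\bm{\gamma}}i=\{{\ast}^{\bm{\gamma}}j:0\le j<i\}^{\gamma_i}$ recursively; $\bm{0}=(0,0,\ldots)$, $\bm{1}=(1,1,\ldots)$. $\mathcal{G}(G^g)=\mathrm{mex}\{\mathcal{G}(G'^{g'}):G'^{g'}\in G^g\}$ recursively (Grundy number ignoring activeness), where $\mathrm{mex}\,S=\min(\mathbb{Z}_{\ge0}\setminus S)$. $\oplus$ is bitwise XOR. -}

module Defs where

open import Data.Nat using (ℕ; zero; suc; _+_; _*_; _≟_)
open import Data.Nat.DivMod using (_/_; _%_)
open import Data.Fin using (Fin; zero; suc; splitAt)
open import Data.Bool using (Bool; true; false; _∧_; _∨_; not; if_then_else_)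
open import Data.Sum using ([_,_])
open import Data.Product using (_×_; Σ)
open import Relation.Binary.PropositionalEquality using (_≡_)
open import Relation.Nullary.Decidable using (⌊_⌋)

-- Games with activeness: a finite family of options together with an
-- activeness bit.  Options form a *set* in the paper; here they are a
-- finite indexed family, and identity of sets is recovered by the
-- extensional relation _≅_ below (ignoring order and repetitions).
data Game : Set where
  mk : (n : ℕ) → (Fin n → Game) → Bool → Game

∅¹ : Game
∅¹ = mk 0 (λ ()) true

anyFin : (n : ℕ) → (Fin n → Bool) → Bool
anyFin zero    p = false
anyFin (suc n) p = p zero ∨ anyFin n (λ i → p (suc i))

infix 4 _≅_
_≅_ : Game → Game → Set
mk n f g ≅ mk m h b =
  (g ≡ b) ×
  (((i : Fin n) → Σ (Fin m) λ j → f i ≅ h j) ×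
   ((j : Fin m) → Σ (Fin n) λ i → f i ≅ h j))

data Outcome : Set where
  𝒩 𝒫 : Outcome

isP : Game → Bool
isP (mk n f g) = not (g ∧ anyFin n (λ i → isP (f i)))

o : Game → Outcome
o G = if isP G then 𝒫 else 𝒩

infixl 6 _⊞_
_⊞_ : Game → Game → Game
mk n f g ⊞ mk m h b =
  mk (n + m)
     (λ k → [ (λ i → f i ⊞ mk m h b) , (λ j → mk n f g ⊞ h j) ] (splitAt n k))
     (g ∨ b)

infix 4 _≈_
_≈_ : Game → Game → Set
G ≈ H = (X : Game) → o (G ⊞ X) ≡ o (H ⊞ X)

Seq : Set
Seq = ℕ → Bool

𝟎 𝟏 : Seq
𝟎 _ = false
𝟏 _ = true

mutual
  star : Seq → ℕ → Game
  star γ i = mk i (stars γ i) (γ i)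

  stars : Seq → (i : ℕ) → Fin i → Game
  stars γ (suc i) zero    = star γ i
  stars γ (suc i) (suc j) = stars γ i j

inImage : (n : ℕ) → (Fin n → ℕ) → ℕ → Bool
inImage n f k = anyFin n (λ i → ⌊ f i ≟ k ⌋)

mexFrom : (n : ℕ) → (Fin n → ℕ) → ℕ → ℕ → ℕ
mexFrom n f zero       k = k
mexFrom n f (suc fuel) k = if inImage n f k then mexFrom n f fuel (suc k) else k

mex : (n : ℕ) → (Fin n → ℕ) → ℕ
mex n f = mexFrom n f n 0

-- Grundy value ignoring activeness
grundy : Game → ℕ
grundy (mk n f g) = mex n (λ i → grundy (f i))

-- bitwise XOR on ℕ (fuel-bounded binary recursion; fuel a + b suffices)
xorF : ℕ → ℕ → ℕ → ℕ
xorF zero       a b = 0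
xorF (suc fuel) a b =
  (if ⌊ a % 2 ≟ b % 2 ⌋ then 0 else 1) + 2 * xorF fuel (a / 2) (b / 2)

infixl 7 _⊕_
_⊕_ : ℕ → ℕ → ℕ
a ⊕ b = xorF (a + b) a b

-- Nim sums are computed digit by digit, so a ⊕ b is cancellative and every c < a ⊕ b
-- equals a′ ⊕ b or a ⊕ b′ for some a′ < a or b′ < b (induction on halving a and b).
-- Together with the mex characterisation of grundy this gives the Sprague–Grundy sum
-- rule grundy (A ⊞ B) = grundy A ⊕ grundy B, which ignores activeness.
-- A sum with a summand that is active at every position is again active at every
-- position, and for such games the outcome is 𝒫 exactly when the Grundy value is 0; this yields (ii) and the last two
-- equalities of (iii). Games inactive at every position with the same Grundy value can
-- replace each other in any sum, by the classical Sprague–Grundy strategy-copying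
-- argument, which yields the first equality of (iii). Adding ∅¹ switches every
-- activeness bit of *^γ a on without changing the options, which is (i).

module Submission where

open import Defs
open import Data.Bool using (Bool; true; false; _∨_; if_then_else_)
open import Data.Bool.Properties using (∨-zeroʳ; ∨-idem; ¬-not; T-≡)
open import Data.Empty using (⊥-elim)
open import Data.Fin using (Fin; zero; suc; toℕ; splitAt; _↑ˡ_; _↑ʳ_)
open import Data.Fin.Properties using (pigeonhole; toℕ<n; splitAt-↑ˡ; splitAt-↑ʳ)
open import Data.Nat
open import Data.Nat.DivMod
open import Data.Nat.Properties
open import Data.Product using (∃-syntax; _×_; _,_; proj₁; proj₂)
open import Data.Sum using (_⊎_; inj₁; inj₂; [_,_])
open import Function using (_∘_)
open import Function.Bundles using (Equivalence)
open import Relation.Binary.Definitions using (tri<; tri≈; tri>)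
open import Relation.Binary.PropositionalEquality using (_≡_; _≢_; refl; sym; trans; cong; cong₂; subst; subst₂; module ≡-Reasoning)
open import Relation.Nullary using (¬_; contradiction)
open import Relation.Nullary.Decidable using (⌊_⌋; toWitness; fromWitness)

data IsBit : ℕ → Set where
  bit0 : IsBit 0
  bit1 : IsBit 1

parity-isBit : ∀ n → IsBit (n % 2)
parity-isBit n with n % 2 | m%n<n n 2
... | 0           | _ = bit0
... | 1           | _ = bit1
... | suc (suc _) | s≤s (s≤s ())

parity-decomposition : ∀ n → n ≡ n % 2 + 2 * (n / 2)
parity-decomposition n = trans (m≡m%n+[m/n]*n n 2) (cong (n % 2 +_) (*-comm (n / 2) 2))

[δ+2x]%2≡δ : ∀ {δ} → IsBit δ → ∀ x → (δ + 2 * x) % 2 ≡ δ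
[δ+2x]%2≡δ bit0 x = trans (cong (_% 2) (*-comm 2 x)) (m*n%n≡0 x 2)
[δ+2x]%2≡δ bit1 x = trans (cong (λ m → (1 + m) % 2) (*-comm 2 x)) ([m+kn]%n≡m%n 1 x 2)

[δ+2x]/2≡x : ∀ {δ} → IsBit δ → ∀ x → (δ + 2 * x) / 2 ≡ x
[δ+2x]/2≡x bit0 x = trans (cong (_/ 2) (*-comm 2 x)) (m*n/n≡m x 2)
[δ+2x]/2≡x bit1 x = begin
  (1 + 2 * x) / 2    ≡⟨ cong (λ m → (1 + m) / 2) (*-comm 2 x) ⟩
  (1 + x * 2) / 2    ≡⟨ +-distrib-/ 1 (x * 2) (subst (λ r → 1 + r < 2) (sym (m*n%n≡0 x 2)) ≤-refl) ⟩
  1 / 2 + x * 2 / 2  ≡⟨ m*n/n≡m x 2 ⟩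
  x                  ∎
  where open ≡-Reasoning

δ+2x-injective : ∀ {δ δ′ x x′} → IsBit δ → IsBit δ′ →
                   δ + 2 * x ≡ δ′ + 2 * x′ → δ ≡ δ′ × x ≡ x′
δ+2x-injective {δ} {δ′} {x} {x′} d d′ e =
  trans (sym ([δ+2x]%2≡δ d x)) (trans (cong (_% 2) e) ([δ+2x]%2≡δ d′ x′)) ,
  trans (sym ([δ+2x]/2≡x d x)) (trans (cong (_/ 2) e) ([δ+2x]/2≡x d′ x′))

δ+2x<δ′+2y-cases : ∀ {δ δ′ x y} → IsBit δ → IsBit δ′ → δ + 2 * x < δ′ + 2 * y →
                   x < y ⊎ (x ≡ y × δ ≡ 0 × δ′ ≡ 1)
δ+2x<δ′+2y-cases {x = x} {y} bit0 bit0 lt = inj₁ (*-cancelˡ-< 2 x y lt)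
δ+2x<δ′+2y-cases {x = x} {y} bit1 bit1 lt = inj₁ (*-cancelˡ-< 2 x y (s<s⁻¹ lt))
δ+2x<δ′+2y-cases {x = x} {y} bit1 bit0 lt = inj₁ (*-cancelˡ-< 2 x y (<-trans (n<1+n _) lt))
δ+2x<δ′+2y-cases {x = x} {y} bit0 bit1 lt with m≤n⇒m<n∨m≡n (*-cancelˡ-≤ {x} {y} 2 (s≤s⁻¹ lt))
... | inj₁ x<y = inj₁ x<y
... | inj₂ x≡y = inj₂ (x≡y , refl , refl)

x<n/2⇒δ+2x<n : ∀ {δ x} n → IsBit δ → x < n / 2 → δ + 2 * x < n
x<n/2⇒δ+2x<n {δ} {x} n d x<n/2 = begin-strict
  δ + 2 * x    ≤⟨ +-monoˡ-≤ (2 * x) (bit≤1 d) ⟩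
  1 + 2 * x    <⟨ ≤-reflexive (sym (*-suc 2 x)) ⟩
  2 * suc x    ≤⟨ *-monoʳ-≤ 2 x<n/2 ⟩
  2 * (n / 2)  ≡⟨ *-comm 2 (n / 2) ⟩
  n / 2 * 2    ≤⟨ m/n*n≤m n 2 ⟩
  n            ∎
  where
  open ≤-Reasoning
  bit≤1 : ∀ {δ} → IsBit δ → δ ≤ 1
  bit≤1 bit0 = z≤n
  bit≤1 bit1 = ≤-refl

xorBit : ℕ → ℕ → ℕ
xorBit x y = if ⌊ x ≟ y ⌋ then 0 else 1

xorBit-isBit : ∀ x y → IsBit (xorBit x y)
xorBit-isBit x y with ⌊ x ≟ y ⌋
... | true  = bit0
... | false = bit1

xorBit-comm : ∀ {x y} → IsBit x → IsBit y → xorBit x y ≡ xorBit y x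
xorBit-comm bit0 bit0 = refl
xorBit-comm bit0 bit1 = refl
xorBit-comm bit1 bit0 = refl
xorBit-comm bit1 bit1 = refl

xorBit-cancelʳ : ∀ {x y} → IsBit x → IsBit y → xorBit (xorBit x y) x ≡ y
xorBit-cancelʳ bit0 bit0 = refl
xorBit-cancelʳ bit0 bit1 = refl
xorBit-cancelʳ bit1 bit0 = refl
xorBit-cancelʳ bit1 bit1 = refl

xorBit-injˡ : ∀ {x y z} → IsBit x → IsBit y → IsBit z → xorBit x z ≡ xorBit y z → x ≡ y
xorBit-injˡ bit0 bit0 _    _  = refl
xorBit-injˡ bit1 bit1 _    _  = refl
xorBit-injˡ bit0 bit1 bit0 ()
xorBit-injˡ bit0 bit1 bit1 ()
xorBit-injˡ bit1 bit0 bit0 ()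
xorBit-injˡ bit1 bit0 bit1 ()

xorBit≡1 : ∀ {x y} → IsBit x → IsBit y → xorBit x y ≡ 1 → (x ≡ 1 × y ≡ 0) ⊎ (x ≡ 0 × y ≡ 1)
xorBit≡1 bit0 bit1 _ = inj₂ (refl , refl)
xorBit≡1 bit1 bit0 _ = inj₁ (refl , refl)
xorBit≡1 bit0 bit0 ()
xorBit≡1 bit1 bit1 ()

halves-≤-pred : ∀ a b → a / 2 + b / 2 ≤ pred (a + b)
halves-≤-pred zero    zero    = z≤n
halves-≤-pred zero    (suc b) = s≤s⁻¹ (m/n<m (suc b) 2 (s≤s (s≤s z≤n)))
halves-≤-pred (suc a) b       =
  s≤s⁻¹ (+-mono-<-≤ (m/n<m (suc a) 2 (s≤s (s≤s z≤n))) (m/n≤m b 2))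

xorF-suc : ∀ f a b → a + b ≤ f → xorF (suc f) a b ≡ xorF f a b
xorF-suc zero    zero    zero    _  = refl
xorF-suc (suc f) a       b       le =
  cong (λ t → xorBit (a % 2) (b % 2) + 2 * t)
       (xorF-suc f (a / 2) (b / 2) (≤-trans (halves-≤-pred a b) (pred-mono-≤ le)))

xorF-saturated : ∀ f a b → a + b ≤ f → xorF f a b ≡ a ⊕ b
xorF-saturated f a b le = begin
  xorF f a b                        ≡⟨ cong (λ g → xorF g a b) (m∸n+n≡m le) ⟨
  xorF (f ∸ (a + b) + (a + b)) a b  ≡⟨ pad (f ∸ (a + b)) ⟩
  a ⊕ b                             ∎
  where
  open ≡-Reasoning
  pad : ∀ k → xorF (k + (a + b)) a b ≡ a ⊕ b
  pad zero    = refl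
  pad (suc k) = trans (xorF-suc (k + (a + b)) a b (m≤n+m (a + b) k)) (pad k)

⊕-unfold : ∀ a b → a ⊕ b ≡ xorBit (a % 2) (b % 2) + 2 * ((a / 2) ⊕ (b / 2))
⊕-unfold a b = begin
  a ⊕ b
    ≡⟨ xorF-saturated (suc (a + b)) a b (n≤1+n _) ⟨
  xorBit (a % 2) (b % 2) + 2 * xorF (a + b) (a / 2) (b / 2)
    ≡⟨ cong (λ t → xorBit (a % 2) (b % 2) + 2 * t) (xorF-saturated (a + b) (a / 2) (b / 2) halves≤) ⟩
  xorBit (a % 2) (b % 2) + 2 * ((a / 2) ⊕ (b / 2))
    ∎
  where
  open ≡-Reasoning
  halves≤ : a / 2 + b / 2 ≤ a + b
  halves≤ = ≤-trans (halves-≤-pred a b) pred[n]≤n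

xorF-comm : ∀ f a b → xorF f a b ≡ xorF f b a
xorF-comm zero    a b = refl
xorF-comm (suc f) a b =
  cong₂ (λ x t → x + 2 * t) (xorBit-comm (parity-isBit a) (parity-isBit b)) (xorF-comm f (a / 2) (b / 2))

⊕-comm : ∀ a b → a ⊕ b ≡ b ⊕ a
⊕-comm a b = trans (xorF-comm (a + b) a b) (cong (λ f → xorF f b a) (+-comm a b))

halving-induction : (P : ℕ → ℕ → Set) → P 0 0 → (∀ a b → P (a / 2) (b / 2) → P a b) → ∀ a b → P a b
halving-induction P base step a b = go (a + b) a b ≤-refl
  where
  go : ∀ n a b → a + b ≤ n → P a b
  go _       zero    zero    _  = base
  go zero    (suc a) b       ()
  go zero    zero    (suc b) ()
  go (suc n) a       b       le =
    step a b (go n (a / 2) (b / 2) (≤-trans (halves-≤-pred a b) (pred-mono-≤ le)))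

⊕-cancelʳ-≡ : ∀ {a a′} b → a ⊕ b ≡ a′ ⊕ b → a ≡ a′
⊕-cancelʳ-≡ {a} {a′} = halving-induction (λ a a′ → ∀ b → a ⊕ b ≡ a′ ⊕ b → a ≡ a′) (λ _ _ → refl) step a a′
  where
  step : ∀ a a′ → (∀ b → (a / 2) ⊕ b ≡ (a′ / 2) ⊕ b → a / 2 ≡ a′ / 2) → ∀ b → a ⊕ b ≡ a′ ⊕ b → a ≡ a′
  step a a′ ih b e = begin
    a                      ≡⟨ parity-decomposition a ⟩
    a % 2 + 2 * (a / 2)    ≡⟨ cong₂ (λ x y → x + 2 * y) same-bit (ih (b / 2) (proj₂ digits)) ⟩
    a′ % 2 + 2 * (a′ / 2)  ≡⟨ parity-decomposition a′ ⟨
    a′                     ∎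
    where
    open ≡-Reasoning
    digits = δ+2x-injective (xorBit-isBit _ _) (xorBit-isBit _ _)
               (trans (sym (⊕-unfold a b)) (trans e (⊕-unfold a′ b)))
    same-bit = xorBit-injˡ (parity-isBit a) (parity-isBit a′) (parity-isBit b) (proj₁ digits)

⊕-cancelˡ-≡ : ∀ a {b b′} → a ⊕ b ≡ a ⊕ b′ → b ≡ b′
⊕-cancelˡ-≡ a {b} {b′} e = ⊕-cancelʳ-≡ a (trans (⊕-comm b a) (trans e (⊕-comm a b′)))

Reachable : ℕ → ℕ → ℕ → Set
Reachable a b c = (∃[ a′ ] a′ < a × a′ ⊕ b ≡ c) ⊎ (∃[ b′ ] b′ < b × a ⊕ b′ ≡ c)

reachable-swap : ∀ {a b c} → Reachable b a c → Reachable a b c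
reachable-swap {a} {b} (inj₁ (b′ , b′<b , e)) = inj₂ (b′ , b′<b , trans (⊕-comm a b′) e)
reachable-swap {a} {b} (inj₂ (a′ , a′<a , e)) = inj₁ (a′ , a′<a , trans (⊕-comm a′ b) e)

-- The low bit of the new summand is forced, its high part p is chosen by recursion.
⊕-solveˡ : ∀ b c p → p ⊕ (b / 2) ≡ c / 2 → (xorBit (b % 2) (c % 2) + 2 * p) ⊕ b ≡ c
⊕-solveˡ b c p e = begin
  a′ ⊕ b                                            ≡⟨ ⊕-unfold a′ b ⟩
  xorBit (a′ % 2) (b % 2) + 2 * ((a′ / 2) ⊕ (b / 2))
    ≡⟨ cong₂ (λ x y → xorBit x (b % 2) + 2 * (y ⊕ (b / 2))) ([δ+2x]%2≡δ low p) ([δ+2x]/2≡x low p) ⟩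
  xorBit (xorBit (b % 2) (c % 2)) (b % 2) + 2 * (p ⊕ (b / 2))
    ≡⟨ cong₂ (λ x y → x + 2 * y) (xorBit-cancelʳ (parity-isBit b) (parity-isBit c)) e ⟩
  c % 2 + 2 * (c / 2)                               ≡⟨ parity-decomposition c ⟨
  c                                                 ∎
  where
  open ≡-Reasoning
  low = xorBit-isBit (b % 2) (c % 2)
  a′ = xorBit (b % 2) (c % 2) + 2 * p

reachable-lowerˡ : ∀ a b c p → p ⊕ (b / 2) ≡ c / 2 → xorBit (b % 2) (c % 2) + 2 * p < a → Reachable a b c
reachable-lowerˡ a b c p e lt = inj₁ (_ , lt , ⊕-solveˡ b c p e)

reachable-lowerʳ : ∀ a b c q → (a / 2) ⊕ q ≡ c / 2 → xorBit (a % 2) (c % 2) + 2 * q < b → Reachable a b c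
reachable-lowerʳ a b c q e lt = reachable-swap (reachable-lowerˡ b a c q (trans (⊕-comm q (a / 2)) e) lt)

odd⇒2[n/2]<n : ∀ n → n % 2 ≡ 1 → 2 * (n / 2) < n
odd⇒2[n/2]<n n odd =
  subst (2 * (n / 2) <_) (sym (trans (parity-decomposition n) (cong (_+ 2 * (n / 2)) odd))) ≤-refl

⊕-reachable : ∀ a b c → c < a ⊕ b → Reachable a b c
⊕-reachable = halving-induction (λ a b → ∀ c → c < a ⊕ b → Reachable a b c) (λ _ ()) step
  where
  step : ∀ a b → (∀ r → r < (a / 2) ⊕ (b / 2) → Reachable (a / 2) (b / 2) r) →
         ∀ c → c < a ⊕ b → Reachable a b c
  step a b ih c lt
    with δ+2x<δ′+2y-cases (parity-isBit c) (xorBit-isBit (a % 2) (b % 2))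
                          (subst₂ _<_ (parity-decomposition c) (⊕-unfold a b) lt)
  ... | inj₁ r<s with ih (c / 2) r<s
  ...   | inj₁ (p , p< , e) = reachable-lowerˡ a b c p e (x<n/2⇒δ+2x<n a (xorBit-isBit (b % 2) (c % 2)) p<)
  ...   | inj₂ (q , q< , e) = reachable-lowerʳ a b c q e (x<n/2⇒δ+2x<n b (xorBit-isBit (a % 2) (c % 2)) q<)
  step a b ih c lt | inj₂ (r≡s , c-even , δ≡1) with xorBit≡1 (parity-isBit a) (parity-isBit b) δ≡1
  ... | inj₁ (a-odd , b-even) =
    reachable-lowerˡ a b c (a / 2) (sym r≡s) (subst (λ δ → δ + 2 * (a / 2) < a) (sym (cong₂ xorBit b-even c-even)) (odd⇒2[n/2]<n a a-odd))
  ... | inj₂ (a-even , b-odd) =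
    reachable-lowerʳ a b c (b / 2) (sym r≡s) (subst (λ δ → δ + 2 * (b / 2) < b) (sym (cong₂ xorBit a-even c-even)) (odd⇒2[n/2]<n b b-odd))

anyFin-witness : ∀ n (p : Fin n → Bool) → anyFin n p ≡ true → ∃[ i ] p i ≡ true
anyFin-witness (suc n) p e with p zero in p0
... | true  = zero , p0
... | false with anyFin-witness n (p ∘ suc) e
...   | i , pi = suc i , pi

anyFin-intro : ∀ n (p : Fin n → Bool) i → p i ≡ true → anyFin n p ≡ true
anyFin-intro (suc n) p zero    e rewrite e = refl
anyFin-intro (suc n) p (suc i) e rewrite anyFin-intro n (p ∘ suc) i e = ∨-zeroʳ (p zero)

inImage-witness : ∀ n f k → inImage n f k ≡ true → ∃[ i ] f i ≡ k
inImage-witness n f k e with anyFin-witness n _ e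
... | i , fi≟k = i , toWitness (Equivalence.from T-≡ fi≟k)

inImage-intro : ∀ n f k i → f i ≡ k → inImage n f k ≡ true
inImage-intro n f k i e = anyFin-intro n _ i (Equivalence.to T-≡ (fromWitness e))

record IsMex (n : ℕ) (f : Fin n → ℕ) (m : ℕ) : Set where
  field
    excluded : ∀ i → f i ≢ m
    attained : ∀ k → k < m → ∃[ i ] f i ≡ k

open IsMex

¬attainsAll≤ : ∀ n (f : Fin n → ℕ) → ¬ (∀ k → k ≤ n → ∃[ i ] f i ≡ k)
¬attainsAll≤ n f attains =
  let i , j , i<j , same = pigeonhole (n<1+n n) (proj₁ ∘ preimage)
  in <-irrefl (trans (sym (proj₂ (preimage i))) (trans (cong f same) (proj₂ (preimage j)))) i<j
  where
  preimage : (k : Fin (suc n)) → ∃[ i ] f i ≡ toℕ k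
  preimage k = attains (toℕ k) (s≤s⁻¹ (toℕ<n k))

-- The fuel n of mex suffices: by pigeonhole, n + 1 values cannot all be attained by f.
mexFrom-isMex : ∀ {n} (f : Fin n → ℕ) fuel k → fuel + k ≡ n →
                (∀ j → j < k → ∃[ i ] f i ≡ j) → IsMex n f (mexFrom n f fuel k)
mexFrom-isMex {n} f zero k refl below = record { excluded = excl ; attained = below }
  where
  excl : ∀ i → f i ≢ k
  excl i fi≡k = ¬attainsAll≤ k f λ j j≤k → case (m≤n⇒m<n∨m≡n j≤k)
    where
    case : ∀ {j} → j < k ⊎ j ≡ k → ∃[ i ] f i ≡ j
    case (inj₁ j<k)  = below _ j<k
    case (inj₂ refl) = i , fi≡k
mexFrom-isMex {n} f (suc fuel) k e below with inImage n f k in hit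
... | true  = mexFrom-isMex f fuel (suc k) (trans (+-suc fuel k) e) below′
  where
  below′ : ∀ j → j < suc k → ∃[ i ] f i ≡ j
  below′ j j<1+k with m≤n⇒m<n∨m≡n (s≤s⁻¹ j<1+k)
  ... | inj₁ j<k  = below j j<k
  ... | inj₂ refl = inImage-witness n f k hit
... | false = record
  { excluded = λ i fi≡k → contradiction (trans (sym hit) (inImage-intro n f k i fi≡k)) λ ()
  ; attained = below
  }

mex-isMex : ∀ n f → IsMex n f (mex n f)
mex-isMex n f = mexFrom-isMex f n 0 (+-identityʳ n) (λ _ ())

isMex-unique : ∀ {n f m m′} → IsMex n f m → IsMex n f m′ → m ≡ m′
isMex-unique {m = m} {m′} M M′ with <-cmp m m′
... | tri< m<m′ _ _ = let i , fi≡m = attained M′ m m<m′ in contradiction fi≡m (excluded M i)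
... | tri≈ _ m≡m′ _ = m≡m′
... | tri> _ _ m′<m = let i , fi≡m′ = attained M m′ m′<m in contradiction fi≡m′ (excluded M′ i)

arity : Game → ℕ
arity (mk n _ _) = n

opt : (G : Game) → Fin (arity G) → Game
opt (mk _ f _) = f

act : Game → Bool
act (mk _ _ g) = g

grundy-isMex : ∀ G → IsMex (arity G) (grundy ∘ opt G) (grundy G)
grundy-isMex (mk n f _) = mex-isMex n (grundy ∘ f)

grundy-unique : ∀ G {m} → IsMex (arity G) (grundy ∘ opt G) m → grundy G ≡ m
grundy-unique G = isMex-unique (grundy-isMex G)

⊞-act : ∀ A B → act (A ⊞ B) ≡ act A ∨ act B
⊞-act (mk _ _ _) (mk _ _ _) = refl

⊞-actʳ : ∀ A {B} → act B ≡ true → act (A ⊞ B) ≡ true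
⊞-actʳ A {B} actB = trans (⊞-act A B) (trans (cong (act A ∨_) actB) (∨-zeroʳ (act A)))

⊞-opt-cases : ∀ A B k → (∃[ i ] opt (A ⊞ B) k ≡ opt A i ⊞ B) ⊎ (∃[ j ] opt (A ⊞ B) k ≡ A ⊞ opt B j)
⊞-opt-cases (mk n _ _) (mk _ _ _) k with splitAt n k
... | inj₁ i = inj₁ (i , refl)
... | inj₂ j = inj₂ (j , refl)

⊞-optˡ : ∀ A B i → ∃[ k ] opt (A ⊞ B) k ≡ opt A i ⊞ B
⊞-optˡ (mk n _ _) (mk m _ _) i = i ↑ˡ m , cong [ _ , _ ] (splitAt-↑ˡ n i m)

⊞-optʳ : ∀ A B j → ∃[ k ] opt (A ⊞ B) k ≡ A ⊞ opt B j
⊞-optʳ (mk n _ _) (mk m _ _) j = n ↑ʳ j , cong [ _ , _ ] (splitAt-↑ʳ n m j)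

⊞-options : ∀ (P : Game → Set) A B → (∀ i → P (opt A i ⊞ B)) → (∀ j → P (A ⊞ opt B j)) →
            ∀ k → P (opt (A ⊞ B) k)
⊞-options P A B left right k with ⊞-opt-cases A B k
... | inj₁ (i , q) = subst P (sym q) (left i)
... | inj₂ (j , q) = subst P (sym q) (right j)

grundy-⊞-from-options : ∀ A B →
  (∀ i → grundy (opt A i ⊞ B) ≡ grundy (opt A i) ⊕ grundy B) →
  (∀ j → grundy (A ⊞ opt B j) ≡ grundy A ⊕ grundy (opt B j)) →
  grundy (A ⊞ B) ≡ grundy A ⊕ grundy B
grundy-⊞-from-options A B left right =
  grundy-unique (A ⊞ B) record { excluded = excl ; attained = attain }
  where
  excl : ∀ k → grundy (opt (A ⊞ B) k) ≢ grundy A ⊕ grundy B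
  excl k e with ⊞-opt-cases A B k
  ... | inj₁ (i , q) = excluded (grundy-isMex A) i
        (⊕-cancelʳ-≡ (grundy B) (trans (sym (left i)) (trans (cong grundy (sym q)) e)))
  ... | inj₂ (j , q) = excluded (grundy-isMex B) j
        (⊕-cancelˡ-≡ (grundy A) (trans (sym (right j)) (trans (cong grundy (sym q)) e)))
  attain : ∀ c → c < grundy A ⊕ grundy B → ∃[ k ] grundy (opt (A ⊞ B) k) ≡ c
  attain c c< with ⊕-reachable (grundy A) (grundy B) c c<
  ... | inj₁ (a′ , a′< , e) =
    let i , gi≡a′ = attained (grundy-isMex A) a′ a′<
        k , q = ⊞-optˡ A B i
    in k , trans (cong grundy q) (trans (left i) (trans (cong (_⊕ grundy B) gi≡a′) e))
  ... | inj₂ (b′ , b′< , e) =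
    let j , gj≡b′ = attained (grundy-isMex B) b′ b′<
        k , q = ⊞-optʳ A B j
    in k , trans (cong grundy q) (trans (right j) (trans (cong (grundy A ⊕_) gj≡b′) e))

grundy-⊞ : ∀ A B → grundy (A ⊞ B) ≡ grundy A ⊕ grundy B
grundy-⊞ A@(mk _ f _) B@(mk _ h _) =
  grundy-⊞-from-options A B (λ i → grundy-⊞ (f i) B) (λ j → grundy-⊞ A (h j))

mutual
  grundy-star : ∀ γ a → grundy (star γ a) ≡ a
  grundy-star γ a = grundy-unique (star γ a) record
    { excluded = λ i e → <-irrefl e (grundy-stars< γ a i)
    ; attained = stars-attain γ a
    }

  grundy-stars< : ∀ γ a i → grundy (stars γ a i) < a
  grundy-stars< γ (suc a) zero    = ≤-reflexive (cong suc (grundy-star γ a))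
  grundy-stars< γ (suc a) (suc i) = m<n⇒m<1+n (grundy-stars< γ a i)

  stars-attain : ∀ γ a k → k < a → ∃[ i ] grundy (stars γ a i) ≡ k
  stars-attain γ (suc a) k k<1+a with m≤n⇒m<n∨m≡n (s≤s⁻¹ k<1+a)
  ... | inj₁ k<a  = let i , e = stars-attain γ a k k<a in suc i , e
  ... | inj₂ refl = zero , grundy-star γ k

data Uniform (b : Bool) : Game → Set where
  uniform : ∀ {n f} → (∀ i → Uniform b (f i)) → Uniform b (mk n f b)

uniform-opt : ∀ {b G} → Uniform b G → ∀ i → Uniform b (opt G i)
uniform-opt (uniform u) = u

uniform-intro : ∀ {b} G → act G ≡ b → (∀ i → Uniform b (opt G i)) → Uniform b G
uniform-intro (mk _ _ _) refl u = uniform u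

uniform-⊞ : ∀ {b A B} → Uniform b A → Uniform b B → Uniform b (A ⊞ B)
uniform-⊞ {b} {A} {B} uA@(uniform uA′) uB@(uniform uB′) =
  uniform-intro (A ⊞ B) (∨-idem b)
    (⊞-options (Uniform b) A B (λ i → uniform-⊞ (uA′ i) uB) (λ j → uniform-⊞ uA (uB′ j)))

active-⊞ˡ : ∀ {A} B → Uniform true A → Uniform true (A ⊞ B)
active-⊞ˡ {A} B@(mk _ h _) uA@(uniform uA′) =
  uniform-intro (A ⊞ B) refl
    (⊞-options (Uniform true) A B (λ i → active-⊞ˡ B (uA′ i)) (λ j → active-⊞ˡ (h j) uA))

active-⊞ʳ : ∀ A {B} → Uniform true B → Uniform true (A ⊞ B)
active-⊞ʳ A@(mk _ f _) {B} uB@(uniform uB′) =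
  uniform-intro (A ⊞ B) (⊞-actʳ A {B} refl)
    (⊞-options (Uniform true) A B (λ i → active-⊞ʳ (f i) uB) (λ j → active-⊞ʳ A (uB′ j)))

∅¹-active : Uniform true ∅¹
∅¹-active = uniform λ ()

mutual
  star-uniform : ∀ b a → Uniform b (star (λ _ → b) a)
  star-uniform b a = uniform (stars-uniform b a)

  stars-uniform : ∀ b a i → Uniform b (stars (λ _ → b) a i)
  stars-uniform b (suc a) zero    = star-uniform b a
  stars-uniform b (suc a) (suc i) = stars-uniform b a i

isP-inactive : ∀ G → act G ≡ false → isP G ≡ true
isP-inactive (mk _ _ false) refl = refl

isP-false⇒P-option : ∀ G → isP G ≡ false → ∃[ i ] isP (opt G i) ≡ true
isP-false⇒P-option (mk n f true) e with anyFin n (isP ∘ f) in some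
... | true = anyFin-witness n _ some

P-option⇒isP-false : ∀ G i → act G ≡ true → isP (opt G i) ≡ true → isP G ≡ false
P-option⇒isP-false (mk n f true) i refl e rewrite anyFin-intro n (isP ∘ f) i e = refl

isP-true⇒option-not-P : ∀ G i → isP G ≡ true → act G ≡ true → isP (opt G i) ≡ false
isP-true⇒option-not-P G i P actG =
  ¬-not λ Pi → contradiction (trans (sym P) (P-option⇒isP-false G i actG Pi)) λ ()

≡-from-false : ∀ {x y : Bool} → (x ≡ false → y ≡ false) → (y ≡ false → x ≡ false) → x ≡ y
≡-from-false {false} {false} _ _ = refl
≡-from-false {true}  {true}  _ _ = refl
≡-from-false {false} {true}  f _ = sym (f refl)
≡-from-false {true}  {false} _ g = g refl

mutual
  active-P⇒grundy≡0 : ∀ {G} → Uniform true G → isP G ≡ true → grundy G ≡ 0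
  active-P⇒grundy≡0 {G} (uniform u) P = grundy-unique G record
    { excluded = λ i gi≡0 →
        contradiction (trans (sym (isP-true⇒option-not-P G i P refl)) (active-grundy≡0⇒P (u i) gi≡0)) λ ()
    ; attained = λ _ ()
    }

  active-grundy≡0⇒P : ∀ {G} → Uniform true G → grundy G ≡ 0 → isP G ≡ true
  active-grundy≡0⇒P {G} (uniform u) g≡0 = ¬-not λ notP →
    let i , Pi = isP-false⇒P-option G notP
    in excluded (grundy-isMex G) i (trans (active-P⇒grundy≡0 (u i) Pi) (sym g≡0))

active-isP-cong : ∀ {C D} → Uniform true C → Uniform true D → grundy C ≡ grundy D → isP C ≡ isP D
active-isP-cong {C} {D} uC uD e = ≡-from-false (transfer uC uD e) (transfer uD uC (sym e))
  where
  transfer : ∀ {C D} → Uniform true C → Uniform true D → grundy C ≡ grundy D → isP C ≡ false → isP D ≡ false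
  transfer uC uD e notP = ¬-not λ P →
    contradiction (trans (sym notP) (active-grundy≡0⇒P uC (trans e (active-P⇒grundy≡0 uD P)))) λ ()

≈-intro : ∀ {A B} → (∀ X → isP (A ⊞ X) ≡ isP (B ⊞ X)) → A ≈ B
≈-intro same X = cong (λ p → if p then 𝒫 else 𝒩) (same X)

active-≈ : ∀ {A B} → Uniform true A → Uniform true B → grundy A ≡ grundy B → A ≈ B
active-≈ {A} {B} uA uB e = ≈-intro {A} {B} λ X →
  active-isP-cong (active-⊞ˡ X uA) (active-⊞ˡ X uB)
    (trans (grundy-⊞ A X) (trans (cong (_⊕ grundy X) e) (sym (grundy-⊞ B X))))

maxOver : (n : ℕ) → (Fin n → ℕ) → ℕ
maxOver zero    _ = 0
maxOver (suc n) h = h zero ⊔ maxOver n (h ∘ suc)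

≤-maxOver : ∀ n h i → h i ≤ maxOver n h
≤-maxOver (suc n) h zero    = m≤m⊔n (h zero) _
≤-maxOver (suc n) h (suc i) = ≤-trans (≤-maxOver n (h ∘ suc) i) (m≤n⊔m (h zero) _)

height : Game → ℕ
height (mk n f _) = suc (maxOver n (height ∘ f))

height-opt : ∀ G i → height (opt G i) < height G
height-opt (mk n f _) i = s≤s (≤-maxOver n (height ∘ f) i)

-- The height bound N only serves to make the symmetric recursion below terminate.
ExchangeBelow : ℕ → Set
ExchangeBelow N = ∀ {A B} Y → height A + height B + height Y ≤ N →
  Uniform false A → Uniform false B → grundy A ≡ grundy B → isP (A ⊞ Y) ≡ isP (B ⊞ Y)

-- Y is active, so a winning move of A ⊞ Y is answered in B ⊞ Y: a move in Y by the same
-- move, a move to A′ by a move to B′ with the same Grundy value when grundy A′ < grundy B,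
-- and otherwise from A′ ⊞ Y by a move to A″ with grundy A″ = grundy B.
non-P-transfer : ∀ N → ExchangeBelow N → ∀ {A B} Y → height A + height B + height Y ≤ suc N →
                 Uniform false A → Uniform false B → grundy A ≡ grundy B → act Y ≡ true →
                 isP (A ⊞ Y) ≡ false → isP (B ⊞ Y) ≡ false
non-P-transfer N exchange {A} {B} Y le uA uB e actY notP =
  let k , Pk = isP-false⇒P-option (A ⊞ Y) notP in answer k Pk
  where
  below : ∀ {m} → m < height A + height B + height Y → m ≤ N
  below lt = s≤s⁻¹ (≤-trans lt le)

  B⊞Y-moves-to-P : ∀ {C} → (∃[ k ] opt (B ⊞ Y) k ≡ C) → isP C ≡ true → isP (B ⊞ Y) ≡ false
  B⊞Y-moves-to-P (k , q) P = P-option⇒isP-false (B ⊞ Y) k (⊞-actʳ B actY) (trans (cong isP q) P)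

  answer-in-Y : ∀ j → isP (A ⊞ opt Y j) ≡ true → isP (B ⊞ Y) ≡ false
  answer-in-Y j P = B⊞Y-moves-to-P (⊞-optʳ B Y j)
    (trans (sym (exchange (opt Y j) (below (+-monoʳ-< (height A + height B) (height-opt Y j))) uA uB e)) P)

  answer-in-A : ∀ i → isP (opt A i ⊞ Y) ≡ true → isP (B ⊞ Y) ≡ false
  answer-in-A i P with <-cmp (grundy (opt A i)) (grundy B)
  ... | tri≈ _ same _ = ⊥-elim (excluded (grundy-isMex A) i (trans same (sym e)))
  ... | tri< lt _ _ =
    let j , gj = attained (grundy-isMex B) _ lt
        smaller = +-monoˡ-< (height Y) (+-mono-< (height-opt A i) (height-opt B j))
    in B⊞Y-moves-to-P (⊞-optˡ B Y j)
         (trans (sym (exchange Y (below smaller) (uniform-opt uA i) (uniform-opt uB j) (sym gj))) P)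
  ... | tri> _ _ gt =
    let Ai = opt A i
        j , gj = attained (grundy-isMex Ai) _ gt
        k , q = ⊞-optˡ Ai Y j
        smaller = +-monoˡ-< (height Y) (+-monoˡ-< (height B) (<-trans (height-opt Ai j) (height-opt A i)))
    in trans (sym (exchange Y (below smaller) (uniform-opt (uniform-opt uA i) j) uB gj))
             (trans (cong isP (sym q)) (isP-true⇒option-not-P (Ai ⊞ Y) k P (⊞-actʳ Ai actY)))

  answer : ∀ k → isP (opt (A ⊞ Y) k) ≡ true → isP (B ⊞ Y) ≡ false
  answer k P with ⊞-opt-cases A Y k
  ... | inj₁ (i , q) = answer-in-A i (trans (cong isP (sym q)) P)
  ... | inj₂ (j , q) = answer-in-Y j (trans (cong isP (sym q)) P)

inactive-exchange : ∀ N → ExchangeBelow N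
inactive-exchange zero    {mk _ _ _} _ ()
inactive-exchange (suc N) {A} {B} Y le uA@(uniform _) uB@(uniform _) e with act Y in actY
... | false = trans (isP-inactive (A ⊞ Y) (trans (⊞-act A Y) actY))
                    (sym (isP-inactive (B ⊞ Y) (trans (⊞-act B Y) actY)))
... | true  = ≡-from-false
  (non-P-transfer N (inactive-exchange N) Y le uA uB e actY)
  (non-P-transfer N (inactive-exchange N) Y (subst (λ t → t + height Y ≤ suc N) (+-comm (height A) (height B)) le)
                  uB uA (sym e) actY)

inactive-≈ : ∀ {A B} → Uniform false A → Uniform false B → grundy A ≡ grundy B → A ≈ B
inactive-≈ {A} {B} uA uB e = ≈-intro {A} {B} λ X → inactive-exchange _ X ≤-refl uA uB e

mutual
  star-⊞-∅¹ : ∀ γ a → star γ a ⊞ ∅¹ ≅ star 𝟏 a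
  star-⊞-∅¹ γ a = ∨-zeroʳ (γ a) , forth , back
    where
    forth : ∀ k → ∃[ j ] opt (star γ a ⊞ ∅¹) k ≅ stars 𝟏 a j
    forth k with ⊞-opt-cases (star γ a) ∅¹ k
    ... | inj₁ (i , q) = i , subst (_≅ stars 𝟏 a i) (sym q) (stars-⊞-∅¹ γ a i)
    ... | inj₂ (() , _)
    back : ∀ j → ∃[ k ] opt (star γ a ⊞ ∅¹) k ≅ stars 𝟏 a j
    back j = let k , q = ⊞-optˡ (star γ a) ∅¹ j
             in k , subst (_≅ stars 𝟏 a j) (sym q) (stars-⊞-∅¹ γ a j)

  stars-⊞-∅¹ : ∀ γ a i → stars γ a i ⊞ ∅¹ ≅ stars 𝟏 a i
  stars-⊞-∅¹ γ (suc a) zero    = star-⊞-∅¹ γ a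
  stars-⊞-∅¹ γ (suc a) (suc i) = stars-⊞-∅¹ γ a i

theorem3p55 :
    ((γ : Seq) (a : ℕ) → star γ a ⊞ ∅¹ ≅ star 𝟏 a) ×
    (((G : Game) → G ⊞ ∅¹ ≈ star 𝟎 (grundy G) ⊞ ∅¹) ×
     ((a b : ℕ) →
        (star 𝟎 a ⊞ star 𝟎 b ≈ star 𝟎 (a ⊕ b)) ×
        (star 𝟎 a ⊞ star 𝟏 b ≈ star 𝟏 (a ⊕ b)) ×
        (star 𝟏 a ⊞ star 𝟏 b ≈ star 𝟏 (a ⊕ b))))
theorem3p55 = star-⊞-∅¹ , ⊞∅¹-≈ , λ a b →
  inactive-≈ (uniform-⊞ (star-uniform false a) (star-uniform false b)) (star-uniform false (a ⊕ b))
             (grundy-star-⊞ a b) ,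
  active-≈ (active-⊞ʳ (star 𝟎 a) (star-uniform true b)) (star-uniform true (a ⊕ b)) (grundy-star-⊞ a b) ,
  active-≈ (active-⊞ʳ (star 𝟏 a) (star-uniform true b)) (star-uniform true (a ⊕ b)) (grundy-star-⊞ a b)
  where
  ⊞∅¹-≈ : (G : Game) → G ⊞ ∅¹ ≈ star 𝟎 (grundy G) ⊞ ∅¹
  ⊞∅¹-≈ G = active-≈ (active-⊞ʳ G ∅¹-active) (active-⊞ʳ (star 𝟎 (grundy G)) ∅¹-active)
    (trans (grundy-⊞ G ∅¹) (trans (cong (_⊕ 0) (sym (grundy-star 𝟎 (grundy G)))) (sym (grundy-⊞ (star 𝟎 (grundy G)) ∅¹))))
  grundy-star-⊞ : ∀ {γ δ ε} a b → grundy (star γ a ⊞ star δ b) ≡ grundy (star ε (a ⊕ b))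
  grundy-star-⊞ {γ} {δ} {ε} a b =
    trans (grundy-⊞ (star γ a) (star δ b))
          (trans (cong₂ _⊕_ (grundy-star γ a) (grundy-star δ b)) (sym (grundy-star ε (a ⊕ b))))
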